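{- Let $a,b\in\mathbb{Z}$, $q\in\mathbb{Z}\setminus\{0\}$, and $w_r=w_r(a,b,q)$ given by $w_0=a$, $w_1=b$, $w_r=qw_{r-1}+w_{r-2}$. Let $p$ be an odd prime and $m$ a positive integer with $p\mid\gcd(q^2+4,m)$. Suppose that $k(pm)=pk(m)$ and that $(w_r)$ modulo $m$ is residue complete. Then $(w_r)$ modulo $pm$ is residue complete.
   Context: For a positive integer $n$, $k(n)$ denotes the order of $\sigma=\begin{pmatrix} q&1\\ 1&0\end{pmatrix}$ modulo $n$, i.e. the smallest positive integer $k$ with $\sigma^k\equiv I\pmod n$. A sequence is residue complete modulo $n$ if every residue class of $\mathbb{Z}_n$ occurs among its terms modulo $n$. -}

module Defs where

open import Data.Nat as ℕ using (ℕ; zero; suc)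
open import Data.Integer using (ℤ; +_; _+_; _*_; _-_)
open import Data.Integer.Divisibility using (_∣_)
open import Data.Product using (_×_; ∃-syntax)

w : ℤ → ℤ → ℤ → ℕ → ℤ
w a b q zero = a
w a b q (suc zero) = b
w a b q (suc (suc r)) = q * w a b q (suc r) + w a b q r

_≡_[mod_] : ℤ → ℤ → ℕ → Set
x ≡ y [mod n ] = (+ n) ∣ (x - y)

record M2 : Set where
  constructor mat
  field
    e11 e12 e21 e22 : ℤ

_⊗_ : M2 → M2 → M2
mat a b c d ⊗ mat a' b' c' d' =
  mat (a * a' + b * c') (a * b' + b * d') (c * a' + d * c') (c * b' + d * d')

I2 : M2
I2 = mat (+ 1) (+ 0) (+ 0) (+ 1)

_^M_ : M2 → ℕ → M2
A ^M zero = I2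
A ^M suc k = A ⊗ (A ^M k)

σ : ℤ → M2
σ q = mat q (+ 1) (+ 1) (+ 0)

_≡M_[mod_] : M2 → M2 → ℕ → Set
mat a b c d ≡M mat a' b' c' d' [mod n ] =
  (a ≡ a' [mod n ]) × (b ≡ b' [mod n ]) × (c ≡ c' [mod n ]) × (d ≡ d' [mod n ])

IsOrder : ℤ → ℕ → ℕ → Set
IsOrder q n k =
  (0 ℕ.< k) × ((σ q ^M k) ≡M I2 [mod n ]) ×
  (∀ j → 0 ℕ.< j → (σ q ^M j) ≡M I2 [mod n ] → k ℕ.≤ j)

ResidueComplete : (ℕ → ℤ) → ℕ → Set
ResidueComplete s n = ∀ (c : ℤ) → ∃[ r ] (s r ≡ c [mod n ])

module Submission where

-- Write W = w(a,b,q).  Since σᵏ ≡ I (mod m) we have σᵏ = I + m·N with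
-- N = [[qβ + δ, β], [β, δ]], and σᵏ moves the sequence k steps, so
-- W(k + r) = W(r) + m·c(r) with the drift c(r) = β·W(r+1) + δ·W(r).  Iterating
-- gives W(jk + r) ≡ W(r) + j·m·c(r) (mod m²), hence modulo p·m.  If p ∤ c(r),
-- j can be chosen so that this hits any prescribed residue modulo p·m that is
-- ≡ W(r) (mod m); residue completeness modulo m supplies such an r.
-- That p ∤ c(r) is the heart of the matter: det σᵏ = ±1 forces qβ + 2δ ≡ 0
-- (mod p), minimality of the order p·k forces p ∤ β, so 2c(r) ≡ β·e(r) with
-- e(r) = 2W(r+1) − qW(r); and as p ∣ q² + 4, a single vanishing e(r) would make
-- W(r) ≡ (const)·(q/2)^r modulo p, which cannot be residue complete.

open import Defs
open import Data.Nat as N using (ℕ; zero; suc; _<_; NonZero; NonTrivial; nonTrivial⇒n>1; nonTrivial⇒≢1)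
import Data.Nat.Properties as NP
open import Data.Nat.Divisibility as ND using ()
open import Data.Nat.Primality using (Prime; euclidsLemma; prime⇒nonZero; prime⇒nonTrivial; prime⇒irreducible)
open import Data.Nat.Coprimality using (Coprime; coprime-Bézout)
open import Data.Nat.GCD using (module Bézout)
open import Data.Integer using (ℤ; +_; -[1+_]; _+_; _*_; _-_; -_; ∣_∣)
import Data.Integer.Properties as ZP
open import Data.Integer.Divisibility using (_∣_)
open import Data.Integer.Divisibility.Signed as S using (divides)
open import Data.Integer.DivMod using (_%ℕ_; _/ℕ_; a≡a%ℕn+[a/ℕn]*n)
open import Data.Integer.Tactic.RingSolver using (solve-∀)
open import Data.Product using (_×_; _,_; proj₁; proj₂; ∃-syntax)
open import Data.Sum as Sum using (_⊎_; inj₁; inj₂)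
open import Data.Empty using (⊥-elim)
open import Function using (id; _∘_)
open import Level using (0ℓ)
open import Relation.Nullary using (¬_)
open import Relation.Binary.Bundles using (Setoid)
open import Relation.Binary.PropositionalEquality
  using (_≡_; refl; sym; trans; cong; cong₂; subst; module ≡-Reasoning)
import Relation.Binary.Reasoning.Setoid

-- It is equivalent to the
-- relation x ≡ y [mod n] of Defs (≈⇒mod, mod⇒≈), but as a record its type
-- determines x, y and n, so Agda can infer them in the lemmas below.
infix 4 _≈_⟨mod_⟩
record _≈_⟨mod_⟩ (x y : ℤ) (n : ℕ) : Set where
  constructor offset
  field
    quotient : ℤ
    equation : x ≡ y + quotient * + n

≈⇒mod : ∀ {n x y} → x ≈ y ⟨mod n ⟩ → x ≡ y [mod n ]
≈⇒mod {y = y} (offset t refl) = S.∣⇒∣ᵤ (divides t (cancel y (t * + _)))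
  where
  cancel : ∀ y z → y + z - y ≡ z
  cancel = solve-∀

mod⇒≈ : ∀ {n x y} → x ≡ y [mod n ] → x ≈ y ⟨mod n ⟩
mod⇒≈ {x = x} {y} h with S.∣ᵤ⇒∣ h
... | divides t eq = offset t (trans (rearrange x y) (cong (λ z → y + z) eq))
  where
  rearrange : ∀ x y → x ≡ y + (x - y)
  rearrange = solve-∀

≈-refl : ∀ {n x} → x ≈ x ⟨mod n ⟩
≈-refl {n} {x} = offset (+ 0) (add-zero x (+ n))
  where
  add-zero : ∀ x n → x ≡ x + + 0 * n
  add-zero = solve-∀

≡⇒≈ : ∀ {n x y} → x ≡ y → x ≈ y ⟨mod n ⟩
≡⇒≈ refl = ≈-refl

≈-sym : ∀ {n x y} → x ≈ y ⟨mod n ⟩ → y ≈ x ⟨mod n ⟩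
≈-sym {n} {y = y} (offset t refl) = offset (- t) (flip y t (+ n))
  where
  flip : ∀ y t n → y ≡ y + t * n + - t * n
  flip = solve-∀

≈-trans : ∀ {n x y z} → x ≈ y ⟨mod n ⟩ → y ≈ z ⟨mod n ⟩ → x ≈ z ⟨mod n ⟩
≈-trans {n} {z = z} (offset t refl) (offset s refl) = offset (s + t) (collect z s t (+ n))
  where
  collect : ∀ z s t n → z + s * n + t * n ≡ z + (s + t) * n
  collect = solve-∀

≈-+ : ∀ {n x x' y y'} → x ≈ x' ⟨mod n ⟩ → y ≈ y' ⟨mod n ⟩ → x + y ≈ x' + y' ⟨mod n ⟩
≈-+ {n} {x' = x'} {y' = y'} (offset t refl) (offset s refl) =
  offset (t + s) (collect x' y' t s (+ n))
  where
  collect : ∀ x y t s n → x + t * n + (y + s * n) ≡ x + y + (t + s) * n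
  collect = solve-∀

≈-* : ∀ {n x x' y y'} → x ≈ x' ⟨mod n ⟩ → y ≈ y' ⟨mod n ⟩ → x * y ≈ x' * y' ⟨mod n ⟩
≈-* {n} {x' = x'} {y' = y'} (offset t refl) (offset s refl) =
  offset (t * y' + x' * s + t * s * + n) (expand x' y' t s (+ n))
  where
  expand : ∀ x y t s n →
           (x + t * n) * (y + s * n) ≡ x * y + (t * y + x * s + t * s * n) * n
  expand = solve-∀

≈-*ˡ : ∀ {n x y} c → x ≈ y ⟨mod n ⟩ → c * x ≈ c * y ⟨mod n ⟩
≈-*ˡ c = ≈-* (≈-refl {x = c})

≈-*ʳ : ∀ {n x y} c → x ≈ y ⟨mod n ⟩ → x * c ≈ y * c ⟨mod n ⟩
≈-*ʳ c h = ≈-* h (≈-refl {x = c})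

≈-+ˡ : ∀ {n x y} c → x ≈ y ⟨mod n ⟩ → c + x ≈ c + y ⟨mod n ⟩
≈-+ˡ c = ≈-+ (≈-refl {x = c})

≈-+ʳ : ∀ {n x y} c → x ≈ y ⟨mod n ⟩ → x + c ≈ y + c ⟨mod n ⟩
≈-+ʳ c h = ≈-+ h (≈-refl {x = c})

modSetoid : ℕ → Setoid 0ℓ 0ℓ
modSetoid n = record
  { Carrier       = ℤ
  ; _≈_           = λ x y → x ≈ y ⟨mod n ⟩
  ; isEquivalence = record { refl = ≈-refl ; sym = ≈-sym ; trans = ≈-trans }
  }

module ModReasoning (n : ℕ) = Relation.Binary.Reasoning.Setoid (modSetoid n)

≈-divisor : ∀ {d n x y} → d ND.∣ n → x ≈ y ⟨mod n ⟩ → x ≈ y ⟨mod d ⟩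
≈-divisor d∣n h = mod⇒≈ (ND.∣-trans d∣n (≈⇒mod h))

multiple≈0 : ∀ {n} t → + n * t ≈ + 0 ⟨mod n ⟩
multiple≈0 {n} t = offset t (commute (+ n) t)
  where
  commute : ∀ n t → n * t ≡ + 0 + t * n
  commute = solve-∀

≈-scale : ∀ {d x y} n → x ≈ y ⟨mod d ⟩ → + n * x ≈ + n * y ⟨mod d N.* n ⟩
≈-scale {d} {y = y} n (offset t refl) =
  offset t (trans (distribute (+ n) y t (+ d)) (cong (λ z → + n * y + t * z) (sym (ZP.pos-* d n))))
  where
  distribute : ∀ n y t d → n * (y + t * d) ≡ n * y + t * (d * n)
  distribute = solve-∀

≈0⇒∣ : ∀ {n x} → x ≈ + 0 ⟨mod n ⟩ → + n ∣ x
≈0⇒∣ {x = x} h = subst (λ z → + _ ∣ z) (ZP.+-identityʳ x) (≈⇒mod h)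

∣⇒≈0 : ∀ {n x} → + n ∣ x → x ≈ + 0 ⟨mod n ⟩
∣⇒≈0 {x = x} h = mod⇒≈ (subst (λ z → + _ ∣ z) (sym (ZP.+-identityʳ x)) h)

remainder≈ : ∀ z n .{{_ : NonZero n}} → + (z %ℕ n) ≈ z ⟨mod n ⟩
remainder≈ z n = ≈-sym (offset (z /ℕ n) (a≡a%ℕn+[a/ℕn]*n z n))

module OddPrime {p : ℕ} (isPrime : Prime p) (p≢2 : ¬ p ≡ 2) where

  private
    instance
      p-nonTrivial : NonTrivial p
      p-nonTrivial = prime⇒nonTrivial isPrime
      p-nonZero : NonZero p
      p-nonZero = prime⇒nonZero isPrime

  euclid : ∀ {x y} → x * y ≈ + 0 ⟨mod p ⟩ → x ≈ + 0 ⟨mod p ⟩ ⊎ y ≈ + 0 ⟨mod p ⟩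
  euclid {x} {y} h = Sum.map ∣⇒≈0 ∣⇒≈0
    (euclidsLemma ∣ x ∣ ∣ y ∣ isPrime (subst (p ND.∣_) (ZP.abs-* x y) (≈0⇒∣ h)))

  1≉0 : ¬ (+ 1 ≈ + 0 ⟨mod p ⟩)
  1≉0 h = nonTrivial⇒≢1 (ND.∣1⇒≡1 (≈0⇒∣ h))

  2≉0 : ¬ (+ 2 ≈ + 0 ⟨mod p ⟩)
  2≉0 h = p≢2 (NP.≤-antisym (ND.∣⇒≤ (≈0⇒∣ h)) (nonTrivial⇒n>1 p))

  cancel : ∀ {u x} → ¬ (u ≈ + 0 ⟨mod p ⟩) → u * x ≈ + 0 ⟨mod p ⟩ → x ≈ + 0 ⟨mod p ⟩
  cancel u≉0 h = Sum.[ (λ u≈0 → ⊥-elim (u≉0 u≈0)) , id ] (euclid h)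

  transfer-zero : ∀ u {v x y} → ¬ (v ≈ + 0 ⟨mod p ⟩) → u * x ≈ v * y ⟨mod p ⟩ →
                  x ≈ + 0 ⟨mod p ⟩ → y ≈ + 0 ⟨mod p ⟩
  transfer-zero u {v} {x} {y} v≉0 ux≈vy x≈0 = cancel v≉0 (begin
    v * y    ≈⟨ ux≈vy ⟨
    u * x    ≈⟨ ≈-*ˡ u x≈0 ⟩
    u * + 0  ≡⟨ ZP.*-zeroʳ u ⟩
    + 0      ∎)
    where open ModReasoning p

  -- If p divides q² + 4 then p does not divide q (otherwise p ∣ 4).
  q≉0 : ∀ q → q * q + + 4 ≈ + 0 ⟨mod p ⟩ → ¬ (q ≈ + 0 ⟨mod p ⟩)
  q≉0 q disc≈0 q≈0 = Sum.[ 2≉0 , 2≉0 ] (euclid (begin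
    + 2 * + 2         ≡⟨⟩
    + 0 * + 0 + + 4   ≈⟨ ≈-+ʳ (+ 4) (≈-* q≈0 q≈0) ⟨
    q * q + + 4       ≈⟨ disc≈0 ⟩
    + 0               ∎))
    where open ModReasoning p

  inverseℕ : ∀ {n} → ¬ (p ND.∣ n) → ∃[ s ] (s * + n ≈ + 1 ⟨mod p ⟩)
  inverseℕ {n} p∤n with coprime-Bézout coprime
    where
    coprime : Coprime n p
    coprime (d∣n , d∣p) = Sum.[ id , (λ d≡p → ⊥-elim (p∤n (subst (ND._∣ n) d≡p d∣n))) ]
                              (prime⇒irreducible isPrime d∣p)
  ... | Bézout.+- a b eq = + a , offset (+ b) (begin
    + a * + n          ≡⟨ ZP.pos-* a n ⟨
    + (a N.* n)        ≡⟨ cong +_ eq ⟨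
    + (1 N.+ b N.* p)  ≡⟨ ZP.pos-+ 1 (b N.* p) ⟩
    + 1 + + (b N.* p)  ≡⟨ cong (λ z → + 1 + z) (ZP.pos-* b p) ⟩
    + 1 + + b * + p    ∎)
    where open ≡-Reasoning
  ... | Bézout.-+ a b eq = - + a , offset (- + b) (begin
    - + a * + n                ≡⟨ negate (+ a) (+ n) ⟩
    + 1 - (+ 1 + + a * + n)    ≡⟨ cong (λ z → + 1 - (+ 1 + z)) (ZP.pos-* a n) ⟨
    + 1 - (+ 1 + + (a N.* n))  ≡⟨ cong (λ z → + 1 - z) (ZP.pos-+ 1 (a N.* n)) ⟨
    + 1 - + (1 N.+ a N.* n)    ≡⟨ cong (λ z → + 1 - + z) eq ⟩
    + 1 - + (b N.* p)          ≡⟨ cong (λ z → + 1 - z) (ZP.pos-* b p) ⟩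
    + 1 - + b * + p            ≡⟨ cong (λ z → + 1 + z) (ZP.neg-distribˡ-* (+ b) (+ p)) ⟩
    + 1 + - + b * + p          ∎)
    where
    open ≡-Reasoning
    negate : ∀ a n → - a * n ≡ + 1 - (+ 1 + a * n)
    negate = solve-∀

  inverse : ∀ {x} → ¬ (x ≈ + 0 ⟨mod p ⟩) → ∃[ s ] (s * x ≈ + 1 ⟨mod p ⟩)
  inverse {+ n}      x≉0 = inverseℕ (λ p∣n → x≉0 (∣⇒≈0 p∣n))
  inverse { -[1+ n ]} x≉0 with inverseℕ {suc n} (λ p∣n → x≉0 (∣⇒≈0 p∣n))
  ... | s , s·n≈1 = - s , ≈-trans (≡⇒≈ (negate-both s (+ suc n))) s·n≈1
    where
    negate-both : ∀ s y → - s * - y ≡ s * y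
    negate-both = solve-∀

  solve-linear : ∀ {c} → ¬ (c ≈ + 0 ⟨mod p ⟩) → ∀ t → ∃[ j ] (t + + j * c ≈ + 0 ⟨mod p ⟩)
  solve-linear {c} c≉0 t with inverse c≉0
  ... | s , s·c≈1 = (- (t * s)) %ℕ p , (begin
    t + + ((- (t * s)) %ℕ p) * c  ≈⟨ ≈-+ˡ t (≈-*ʳ c (remainder≈ (- (t * s)) p)) ⟩
    t + - (t * s) * c             ≡⟨ regroup t s c ⟩
    t + - t * (s * c)             ≈⟨ ≈-+ˡ t (≈-*ˡ (- t) s·c≈1) ⟩
    t + - t * + 1                 ≡⟨ annihilate t ⟩
    + 0                           ∎)
    where
    open ModReasoning p
    regroup : ∀ t s c → t + - (t * s) * c ≡ t + - t * (s * c)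
    regroup = solve-∀
    annihilate : ∀ t → t + - t * + 1 ≡ + 0
    annihilate = solve-∀

  lift : ∀ {m x y c} → x ≈ y ⟨mod m ⟩ → ¬ (c ≈ + 0 ⟨mod p ⟩) →
         ∃[ j ] (x + + m * (+ j * c) ≈ y ⟨mod p N.* m ⟩)
  lift {m} {y = y} {c} (offset t refl) c≉0 with solve-linear c≉0 t
  ... | j , t+jc≈0 = j , (begin
    y + t * + m + + m * (+ j * c)  ≡⟨ collect y t (+ m) (+ j * c) ⟩
    y + + m * (t + + j * c)        ≈⟨ ≈-+ˡ y (≈-scale m t+jc≈0) ⟩
    y + + m * + 0                  ≡⟨ vanish y (+ m) ⟩
    y                              ∎)
    where
    open ModReasoning (p N.* m)
    collect : ∀ y t m x → y + t * m + m * x ≡ y + m * (t + x)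
    collect = solve-∀
    vanish : ∀ y m → y + m * + 0 ≡ y
    vanish = solve-∀

propagate : ∀ {P : ℕ → Set} → (∀ r → P r → P (suc r)) → (∀ r → P (suc r) → P r) →
            ∀ r → P r → ∀ s → P s
propagate {P} up down r h s = from-zero s (to-zero r h)
  where
  to-zero : ∀ r → P r → P 0
  to-zero zero    = id
  to-zero (suc r) = to-zero r ∘ down r
  from-zero : ∀ s → P 0 → P s
  from-zero zero    = id
  from-zero (suc s) = up s ∘ from-zero s

complete-divisor : ∀ {s d n} → d ND.∣ n → ResidueComplete s n → ResidueComplete s d
complete-divisor d∣n complete c with complete c
... | r , hit = r , ND.∣-trans d∣n hit

det : M2 → ℤ
det (mat a b c d) = a * d - b * c

det-⊗ : ∀ A B → det (A ⊗ B) ≡ det A * det B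
det-⊗ (mat a b c d) (mat a' b' c' d') = expand a b c d a' b' c' d'
  where
  expand : ∀ a b c d a' b' c' d' →
           (a * a' + b * c') * (c * b' + d * d') - (a * b' + b * d') * (c * a' + d * c')
           ≡ (a * d - b * c) * (a' * d' - b' * c')
  expand = solve-∀

IsUnit : ℤ → Set
IsUnit z = z ≡ + 1 ⊎ z ≡ - + 1

unit-* : ∀ {x y} → IsUnit x → IsUnit y → IsUnit (x * y)
unit-* (inj₁ refl) (inj₁ refl) = inj₁ refl
unit-* (inj₁ refl) (inj₂ refl) = inj₂ refl
unit-* (inj₂ refl) (inj₁ refl) = inj₂ refl
unit-* (inj₂ refl) (inj₂ refl) = inj₁ refl

-- A unit of the form 1 + n·t, with n > 0 not dividing 2, has t = 0: the
-- alternative 1 + n·t = −1 would give n·t = −2.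
unit-near-one : ∀ {n t} → 0 < n → ¬ (+ 2 ≈ + 0 ⟨mod n ⟩) → IsUnit (+ 1 + + n * t) → t ≡ + 0
unit-near-one {n} {t} 0<n _ (inj₁ is-one)
  with ZP.i*j≡0⇒i≡0∨j≡0 (+ n) (trans (isolate (+ n * t)) (cong (_- + 1) is-one))
  where
  isolate : ∀ x → x ≡ + 1 + x - + 1
  isolate = solve-∀
... | inj₁ n≡0 = ⊥-elim (NP.<⇒≢ 0<n (sym (ZP.+-injective n≡0)))
... | inj₂ t≡0 = t≡0
unit-near-one {n} {t} _ 2≉0 (inj₂ is-minus-one) = ⊥-elim (2≉0 (offset (- t) (begin
  + 2                         ≡⟨⟩
  + 1 - - + 1                 ≡⟨ cong (λ z → + 1 - z) is-minus-one ⟨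
  + 1 - (+ 1 + + n * t)       ≡⟨ rearrange (+ n) t ⟩
  + 0 + - t * + n             ∎)))
  where
  open ≡-Reasoning
  rearrange : ∀ n t → + 1 - (+ 1 + n * t) ≡ + 0 + - t * n
  rearrange = solve-∀

module Sequence (a b q : ℤ) where

  W : ℕ → ℤ
  W = w a b q

  shift : ∀ n r →
    (W (suc (n N.+ r)) ≡ M2.e11 (σ q ^M n) * W (suc r) + M2.e12 (σ q ^M n) * W r) ×
    (W (n N.+ r)       ≡ M2.e21 (σ q ^M n) * W (suc r) + M2.e22 (σ q ^M n) * W r)
  shift zero    r = unit₁ (W (suc r)) (W r) , unit₂ (W (suc r)) (W r)
    where
    unit₁ : ∀ x y → x ≡ + 1 * x + + 0 * y
    unit₁ = solve-∀
    unit₂ : ∀ x y → y ≡ + 0 * x + + 1 * y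
    unit₂ = solve-∀
  shift (suc n) r with shift n r
  ... | top , bottom = trans (cong₂ (λ u v → q * u + v) top bottom) (step₁ q e₁₁ e₁₂ e₂₁ e₂₂ x y)
                     , trans top (step₂ e₁₁ e₁₂ e₂₁ e₂₂ x y)
    where
    e₁₁ e₁₂ e₂₁ e₂₂ x y : ℤ
    e₁₁ = M2.e11 (σ q ^M n)
    e₁₂ = M2.e12 (σ q ^M n)
    e₂₁ = M2.e21 (σ q ^M n)
    e₂₂ = M2.e22 (σ q ^M n)
    x = W (suc r)
    y = W r
    step₁ : ∀ q a b c d x y → q * (a * x + b * y) + (c * x + d * y)
                               ≡ (q * a + + 1 * c) * x + (q * b + + 1 * d) * y
    step₁ = solve-∀
    step₂ : ∀ a b c d x y → a * x + b * y ≡ (+ 1 * a + + 0 * c) * x + (+ 1 * b + + 0 * d) * y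
    step₂ = solve-∀

  -- σⁿ is symmetric and its top-left entry is q·e₂₁ + e₂₂ (σⁿ commutes with σ).
  power-shape : ∀ n → M2.e12 (σ q ^M n) ≡ M2.e21 (σ q ^M n) ×
                      M2.e11 (σ q ^M n) ≡ q * M2.e21 (σ q ^M n) + M2.e22 (σ q ^M n)
  power-shape zero = refl , base q
    where
    base : ∀ q → + 1 ≡ q * + 0 + + 1
    base = solve-∀
  power-shape (suc n) with power-shape n
  ... | symmetric , diagonal rewrite symmetric | diagonal =
        step₁ q (M2.e21 (σ q ^M n)) (M2.e22 (σ q ^M n))
      , step₂ q (M2.e21 (σ q ^M n)) (M2.e22 (σ q ^M n))
    where
    step₁ : ∀ q c d → q * c + + 1 * d ≡ + 1 * (q * c + d) + + 0 * c
    step₁ = solve-∀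
    step₂ : ∀ q c d → q * (q * c + d) + + 1 * c
                      ≡ q * (+ 1 * (q * c + d) + + 0 * c) + (+ 1 * c + + 0 * d)
    step₂ = solve-∀

  det-power : ∀ n → IsUnit (det (σ q ^M n))
  det-power zero    = inj₁ refl
  det-power (suc n) = subst IsUnit (sym (det-⊗ (σ q) (σ q ^M n)))
                        (unit-* (inj₂ (det-σ q)) (det-power n))
    where
    det-σ : ∀ q → q * + 0 - + 1 * + 1 ≡ - + 1
    det-σ = solve-∀

-- Modulo an odd prime p ∣ q² + 4 the characteristic polynomial x² − qx − 1
-- has the double root q/2, so W(r) ≡ (A + B·r)(q/2)^r.  The defect
-- e(r) = 2W(r+1) − q·W(r) measures B: it vanishes at one index only if it
-- vanishes everywhere, and then W is geometric and cannot hit both 0 and 1.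
module DoubleRoot (a b q : ℤ) {p : ℕ} (isPrime : Prime p) (p≢2 : ¬ p ≡ 2)
                  (disc≈0 : q * q + + 4 ≈ + 0 ⟨mod p ⟩) where
  open Sequence a b q
  open OddPrime isPrime p≢2
  open ModReasoning p

  defect : ℕ → ℤ
  defect r = + 2 * W (suc r) - q * W r

  defect-step : ∀ r → + 2 * defect (suc r) ≈ q * defect r ⟨mod p ⟩
  defect-step r = begin
    + 2 * defect (suc r)                    ≡⟨ expand q (W (suc r)) (W r) ⟩
    q * defect r + (q * q + + 4) * W r      ≈⟨ ≈-+ˡ (q * defect r) (≈-*ʳ (W r) disc≈0) ⟩
    q * defect r + + 0 * W r                ≡⟨ drop (q * defect r) (W r) ⟩
    q * defect r                            ∎
    where
    expand : ∀ q x y → + 2 * (+ 2 * (q * x + y) - q * x)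
                       ≡ q * (+ 2 * x - q * y) + (q * q + + 4) * y
    expand = solve-∀
    drop : ∀ x y → x + + 0 * y ≡ x
    drop = solve-∀

  defect-everywhere : ∀ r → defect r ≈ + 0 ⟨mod p ⟩ → ∀ s → defect s ≈ + 0 ⟨mod p ⟩
  defect-everywhere r = propagate
    (λ r → transfer-zero q 2≉0 (≈-sym (defect-step r)))
    (λ r → transfer-zero (+ 2) (q≉0 q disc≈0) (defect-step r))
    r

  -- Once the defect vanishes, 2·W(s+1) ≡ q·W(s), so zeros of W propagate.
  zeros-everywhere : (∀ s → defect s ≈ + 0 ⟨mod p ⟩) →
                     ∀ r → W r ≈ + 0 ⟨mod p ⟩ → ∀ s → W s ≈ + 0 ⟨mod p ⟩
  zeros-everywhere no-defect = propagate
    (λ s → transfer-zero q 2≉0 (≈-sym (geometric s)))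
    (λ s → transfer-zero (+ 2) (q≉0 q disc≈0) (geometric s))
    where
    geometric : ∀ s → + 2 * W (suc s) ≈ q * W s ⟨mod p ⟩
    geometric s = begin
      + 2 * W (suc s)          ≡⟨ split q (W (suc s)) (W s) ⟩
      defect s + q * W s       ≈⟨ ≈-+ʳ (q * W s) (no-defect s) ⟩
      + 0 + q * W s            ≡⟨ ZP.+-identityˡ (q * W s) ⟩
      q * W s                  ∎
      where
      split : ∀ q x y → + 2 * x ≡ + 2 * x - q * y + q * y
      split = solve-∀

  defect≉0 : ResidueComplete W p → ∀ r → ¬ (defect r ≈ + 0 ⟨mod p ⟩)
  defect≉0 complete r defect≈0 with complete (+ 0) | complete (+ 1)
  ... | r₀ , W≡0 | r₁ , W≡1 = 1≉0 (begin
    + 1    ≈⟨ mod⇒≈ W≡1 ⟨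
    W r₁   ≈⟨ zeros-everywhere (defect-everywhere r defect≈0) r₀ (mod⇒≈ W≡0) r₁ ⟩
    + 0    ∎)

below-order : ∀ {q n K j} → IsOrder q n K → 0 < j → j < K → ¬ ((σ q ^M j) ≡M I2 [mod n ])
below-order (_ , _ , minimal) 0<j j<K σʲ≡I = NP.<⇒≱ j<K (minimal _ 0<j σʲ≡I)

mat-cong : ∀ {a b c d a' b' c' d'} → a ≡ a' → b ≡ b' → c ≡ c' → d ≡ d' →
           mat a b c d ≡ mat a' b' c' d'
mat-cong refl refl refl refl = refl

module Drift (a b q : ℤ) (m k : ℕ) (σᵏ≡I : (σ q ^M k) ≡M I2 [mod m ]) where
  open Sequence a b q

  M : ℤ
  M = + m

  private
    corner : M2.e21 (σ q ^M k) ≈ + 0 ⟨mod m ⟩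
    corner = mod⇒≈ (proj₁ (proj₂ (proj₂ σᵏ≡I)))
    diagonal : M2.e22 (σ q ^M k) ≈ + 1 ⟨mod m ⟩
    diagonal = mod⇒≈ (proj₂ (proj₂ (proj₂ σᵏ≡I)))

  β δ : ℤ
  β = _≈_⟨mod_⟩.quotient corner
  δ = _≈_⟨mod_⟩.quotient diagonal

  e21≡ : M2.e21 (σ q ^M k) ≡ M * β
  e21≡ = trans (_≈_⟨mod_⟩.equation corner) (reorder β M)
    where
    reorder : ∀ β M → + 0 + β * M ≡ M * β
    reorder = solve-∀

  e22≡ : M2.e22 (σ q ^M k) ≡ + 1 + M * δ
  e22≡ = trans (_≈_⟨mod_⟩.equation diagonal) (reorder δ M)
    where
    reorder : ∀ δ M → + 1 + δ * M ≡ + 1 + M * δ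
    reorder = solve-∀

  σᵏ-form : σ q ^M k ≡ mat (+ 1 + M * (q * β + δ)) (M * β) (M * β) (+ 1 + M * δ)
  σᵏ-form = mat-cong top-left (trans (proj₁ (power-shape k)) e21≡) e21≡ e22≡
    where
    top-left : M2.e11 (σ q ^M k) ≡ + 1 + M * (q * β + δ)
    top-left = trans (proj₂ (power-shape k))
                 (trans (cong₂ (λ B D → q * B + D) e21≡ e22≡) (collect q M β δ))
      where
      collect : ∀ q M β δ → q * (M * β) + (+ 1 + M * δ) ≡ + 1 + M * (q * β + δ)
      collect = solve-∀

  drift : ℕ → ℤ
  drift r = β * W (suc r) + δ * W r

  period-step : ∀ r → W (k N.+ r) ≡ W r + M * drift r
  period-step r = trans (proj₂ (shift k r))
    (trans (cong₂ (λ B D → B * W (suc r) + D * W r) e21≡ e22≡) (collect M β δ (W (suc r)) (W r)))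
    where
    collect : ∀ M β δ x y → M * β * x + (+ 1 + M * δ) * y ≡ y + M * (β * x + δ * y)
    collect = solve-∀

  private
    reduce : ∀ {x y} t → x ≈ y + M * t ⟨mod m N.* m ⟩ → x ≈ y ⟨mod m ⟩
    reduce {x} {y} t h = begin
      x          ≈⟨ ≈-divisor (ND.∣m⇒∣m*n m ND.∣-refl) h ⟩
      y + M * t  ≈⟨ ≈-+ˡ y (multiple≈0 t) ⟩
      y + + 0    ≡⟨ ZP.+-identityʳ y ⟩
      y          ∎
      where open ModReasoning m

  drift-linear : ∀ j r → W (j N.* k N.+ r) ≈ W r + M * (+ j * drift r) ⟨mod m N.* m ⟩
  drift-linear zero    r = ≡⇒≈ (no-drift (W r) M (drift r))
    where
    no-drift : ∀ w M c → w ≡ w + M * (+ 0 * c)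
    no-drift = solve-∀
  drift-linear (suc j) r = begin
    W (suc j N.* k N.+ r)              ≡⟨ cong W (NP.+-assoc k (j N.* k) r) ⟩
    W (k N.+ X)                        ≡⟨ period-step X ⟩
    W X + M * drift X                  ≈⟨ ≈-+ (drift-linear j r) (≈-scale m drift-returns) ⟩
    W r + M * (+ j * drift r) + M * drift r  ≡⟨ collect (W r) M (+ j) (drift r) ⟩
    W r + M * (+ suc j * drift r)            ∎
    where
    open ModReasoning (m N.* m)
    X : ℕ
    X = j N.* k N.+ r
    W-returns : ∀ s → W (j N.* k N.+ s) ≈ W s ⟨mod m ⟩
    W-returns s = reduce (+ j * drift s) (drift-linear j s)
    drift-returns : drift X ≈ drift r ⟨mod m ⟩
    drift-returns =
      ≈-+ (≈-*ˡ β (subst (λ i → W i ≈ W (suc r) ⟨mod m ⟩) (NP.+-suc (j N.* k) r) (W-returns (suc r))))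
          (≈-*ˡ δ (W-returns r))
    collect : ∀ w M j c → w + M * (j * c) + M * c ≡ w + M * ((+ 1 + j) * c)
    collect = solve-∀

module Lifting (a b q : ℤ) {p m k : ℕ} (isPrime : Prime p) (p≢2 : ¬ p ≡ 2) (0<m : 0 < m)
               (p∣m : p ND.∣ m) (disc≈0 : q * q + + 4 ≈ + 0 ⟨mod p ⟩)
               (order-m : IsOrder q m k) (order-pm : IsOrder q (p N.* m) (p N.* k))
               (complete : ResidueComplete (w a b q) m) where
  open Sequence a b q
  open Drift a b q m k (proj₁ (proj₂ order-m))
  open OddPrime isPrime p≢2
  open DoubleRoot a b q isPrime p≢2 disc≈0

  T : ℤ
  T = q * β + + 2 * δ + M * (q * β * δ + δ * δ - β * β)

  det-σᵏ : det (σ q ^M k) ≡ + 1 + M * T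
  det-σᵏ = trans (cong det σᵏ-form) (expand q M β δ)
    where
    expand : ∀ q M β δ →
      (+ 1 + M * (q * β + δ)) * (+ 1 + M * δ) - M * β * (M * β)
      ≡ + 1 + M * (q * β + + 2 * δ + M * (q * β * δ + δ * δ - β * β))
    expand = solve-∀

  -- det σᵏ = ±1 and p ∤ 2 force T = 0, hence q·β + 2·δ ≡ 0 (mod p).
  trace-relation : q * β + + 2 * δ ≈ + 0 ⟨mod p ⟩
  trace-relation = ≈-divisor p∣m (begin
    q * β + + 2 * δ                ≡⟨ ZP.+-identityʳ (q * β + + 2 * δ) ⟨
    q * β + + 2 * δ + + 0          ≈⟨ ≈-+ˡ (q * β + + 2 * δ) (multiple≈0 _) ⟨
    T                              ≡⟨ T≡0 ⟩
    + 0                            ∎)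
    where
    open ModReasoning m
    T≡0 : T ≡ + 0
    T≡0 = unit-near-one 0<m (λ 2≈0 → 2≉0 (≈-divisor p∣m 2≈0)) (subst IsUnit det-σᵏ (det-power k))

  -- If p divided β it would divide δ, so σᵏ ≡ I (mod p·m) with k < p·k,
  -- contradicting the minimality of the order p·k.
  β≉0 : ¬ (β ≈ + 0 ⟨mod p ⟩)
  β≉0 β≈0 = below-order order-pm 0<k k<pk (subst (λ A → A ≡M I2 [mod p N.* m ]) (sym σᵏ-form)
    ( ≈⇒mod (near (+ 1) (≈-trans (≈-+ (≈-*ˡ q β≈0) δ≈0) (≡⇒≈ (vanish q))))
    , ≈⇒mod (scaled β≈0) , ≈⇒mod (scaled β≈0) , ≈⇒mod (near (+ 1) δ≈0)))
    where
    0<k : 0 < k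
    0<k = proj₁ order-m
    k<pk : k < p N.* k
    k<pk = subst (k <_) (NP.*-comm k p)
                 (NP.m<m*n k p {{N.>-nonZero 0<k}} (nonTrivial⇒n>1 p {{prime⇒nonTrivial isPrime}}))
    vanish : ∀ q → q * + 0 + + 0 ≡ + 0
    vanish = solve-∀
    δ≈0 : δ ≈ + 0 ⟨mod p ⟩
    δ≈0 = cancel 2≉0 (begin
      + 2 * δ                         ≡⟨ isolate q β δ ⟩
      q * β + + 2 * δ + - q * β       ≈⟨ ≈-+ trace-relation (≈-*ˡ (- q) β≈0) ⟩
      + 0 + - q * + 0                 ≡⟨ vanish′ q ⟩
      + 0                             ∎)
      where
      open ModReasoning p
      isolate : ∀ q β δ → + 2 * δ ≡ q * β + + 2 * δ + - q * β
      isolate = solve-∀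
      vanish′ : ∀ q → + 0 + - q * + 0 ≡ + 0
      vanish′ = solve-∀
    scaled : ∀ {x} → x ≈ + 0 ⟨mod p ⟩ → M * x ≈ + 0 ⟨mod p N.* m ⟩
    scaled x≈0 = ≈-trans (≈-scale m x≈0) (≡⇒≈ (ZP.*-zeroʳ M))
    near : ∀ c {x} → x ≈ + 0 ⟨mod p ⟩ → c + M * x ≈ c ⟨mod p N.* m ⟩
    near c x≈0 = ≈-trans (≈-+ˡ c (scaled x≈0)) (≡⇒≈ (ZP.+-identityʳ c))

  -- 2·c(r) ≡ β·e(r) (mod p) by the trace relation, and e(r) ≢ 0 since W is
  -- residue complete modulo p; as β ≢ 0, the drift c(r) is never ≡ 0.
  drift≉0 : ∀ r → ¬ (drift r ≈ + 0 ⟨mod p ⟩)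
  drift≉0 r c≈0 =
    defect≉0 (complete-divisor {s = W} p∣m complete) r (transfer-zero (+ 2) β≉0 twice-drift c≈0)
    where
    open ModReasoning p
    twice-drift : + 2 * drift r ≈ β * defect r ⟨mod p ⟩
    twice-drift = begin
      + 2 * drift r                                ≡⟨ expand q β δ (W (suc r)) (W r) ⟩
      β * defect r + (q * β + + 2 * δ) * W r       ≈⟨ ≈-+ˡ (β * defect r) (≈-*ʳ (W r) trace-relation) ⟩
      β * defect r + + 0 * W r                     ≡⟨ drop (β * defect r) (W r) ⟩
      β * defect r                                 ∎
      where
      expand : ∀ q β δ x y → + 2 * (β * x + δ * y)
                             ≡ β * (+ 2 * x - q * y) + (q * β + + 2 * δ) * y
      expand = solve-∀
      drop : ∀ x y → x + + 0 * y ≡ x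
      drop = solve-∀

lemma3p1 : (a b q : ℤ) → ¬ (q ≡ + 0) →
           (p m : ℕ) → Prime p → ¬ (p ≡ 2) → 0 < m →
           (+ p) ∣ (q * q + + 4) → p ND.∣ m →
           (∃[ k ] (IsOrder q m k × IsOrder q (p N.* m) (p N.* k))) →
           ResidueComplete (w a b q) m →
           ResidueComplete (w a b q) (p N.* m)
lemma3p1 a b q _ p m isPrime p≢2 0<m p∣disc p∣m (k , order-m , order-pm) complete c =
  j N.* k N.+ r , ≈⇒mod (≈-trans (≈-divisor (ND.*-monoˡ-∣ m p∣m) (drift-linear j r)) corrected)
  where
  open Lifting a b q isPrime p≢2 0<m p∣m (∣⇒≈0 p∣disc) order-m order-pm complete
  open Sequence a b q
  open Drift a b q m k (proj₁ (proj₂ order-m))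
  open OddPrime isPrime p≢2
  r : ℕ
  r = proj₁ (complete c)
  hits-mod-m : W r ≈ c ⟨mod m ⟩
  hits-mod-m = mod⇒≈ (proj₂ (complete c))
  j : ℕ
  j = proj₁ (lift hits-mod-m (drift≉0 r))
  corrected : W r + M * (+ j * drift r) ≈ c ⟨mod p N.* m ⟩
  corrected = proj₂ (lift hits-mod-m (drift≉0 r))
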